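{- The symmetric group $S_3$ and the dicyclic group $\mathbb{Z}_3\rtimes\mathbb{Z}_4=\langle a,b\mid a^6=1,\ a^3=b^2,\ bab^{ -1}=a^{ -1}\rangle$ are not Cayley colour integral.
   Context: For a finite group $G$ and $f:G\to\mathbb{C}$ with $f(g)=f(g^{ -1})$, the Cayley colour graph $\operatorname{Cay}(G,f)$ has adjacency matrix $[f(gh^{ -1})]_{g,h\in G}$ and is integral if all its eigenvalues are integers. $G$ is Cayley colour integral if $\operatorname{Cay}(G,f)$ is integral for every $f:G\to\mathbb{Z}$ with $f(g)=f(g^{ -1})$ for all $g\in G$. -}

module Defs where

open import Data.Nat using (ℕ; zero; suc; _+_; _*_; _∸_)
open import Data.Nat.DivMod using (_mod_; _/_; _%_)
open import Data.Fin using (Fin; zero; suc; toℕ; punchIn; _≟_)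
open import Data.Integer as ℤ using (ℤ; 0ℤ; 1ℤ)
open import Data.Bool using (if_then_else_)
open import Data.Product using (∃)
open import Relation.Nullary using (does)
open import Relation.Binary.PropositionalEquality using (_≡_)

sumF : (n : ℕ) → (Fin n → ℤ) → ℤ
sumF zero    v = 0ℤ
sumF (suc n) v = v zero ℤ.+ sumF n (λ i → v (suc i))

prodF : (n : ℕ) → (Fin n → ℤ) → ℤ
prodF zero    v = 1ℤ
prodF (suc n) v = v zero ℤ.* prodF n (λ i → v (suc i))

altSign : ℕ → ℤ
altSign zero    = 1ℤ
altSign (suc k) = ℤ.- altSign k

Matrix : ℕ → Set
Matrix n = Fin n → Fin n → ℤ

det : (n : ℕ) → Matrix n → ℤ
det zero    M = 1ℤ
det (suc n) M =
  sumF (suc n) (λ j → altSign (toℕ j) ℤ.* M zero j ℤ.*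
                      det n (λ r c → M (suc r) (punchIn j c)))

charPolyAt : (n : ℕ) → Matrix n → ℤ → ℤ
charPolyAt n A x = det n (λ i j → (if does (i ≟ j) then x else 0ℤ) ℤ.- A i j)

-- A (symmetric) integer matrix is integral iff all its eigenvalues
-- (roots of the characteristic polynomial, with multiplicity) are
-- integers, i.e. det(xI - A) = ∏ᵢ (x - λᵢ) for integers λ₁,…,λₙ.
-- Both sides are monic polynomials of degree n in x, so the polynomial
-- identity is equivalent to equality at every integer x.
Integral : (n : ℕ) → Matrix n → Set
Integral n A = ∃ λ (ev : Fin n → ℤ) →
  ∀ (x : ℤ) → charPolyAt n A x ≡ prodF n (λ i → x ℤ.- ev i)

cayAdj : (n : ℕ) (mul : Fin n → Fin n → Fin n) (inv : Fin n → Fin n) →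
         (Fin n → ℤ) → Matrix n
cayAdj n mul inv f g h = f (mul g (inv h))

CayleyColourIntegral : (n : ℕ) (mul : Fin n → Fin n → Fin n)
                       (inv : Fin n → Fin n) → Set
CayleyColourIntegral n mul inv =
  ∀ (f : Fin n → ℤ) → (∀ g → f g ≡ f (inv g)) →
  Integral n (cayAdj n mul inv f)

-- Groups of the form ⟨a,b | a^m = 1, b^2 = a^t, b a b⁻¹ = a⁻¹⟩ of
-- order 2m, elements a^i b^j (0 ≤ i < m, 0 ≤ j < 2), encoded as the
-- index i + m*j in Fin (2*m).  Multiplication:
--   (a^i b^j)(a^k b^l) = a^(i + (-1)^j k + [j=l=1] t) b^((j+l) mod 2)
-- Inverse: (a^i)⁻¹ = a^(-i), (a^i b)⁻¹ = a^(i+t) b.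

module Meta (m t : ℕ) where
  pm : ℕ → ℕ → ℕ
  pm zero    k = k
  pm (suc _) k = m ∸ k

  tw : ℕ → ℕ → ℕ
  tw (suc _) (suc _) = t
  tw _       _       = 0


-- S₃ ≅ ⟨a,b | a^3 = b^2 = 1, b a b⁻¹ = a⁻¹⟩ (m = 3, t = 0), elements Fin 6.
S3-mul : Fin 6 → Fin 6 → Fin 6
S3-mul x y =
  let i = toℕ x % 3 ; j = toℕ x / 3 ; k = toℕ y % 3 ; l = toℕ y / 3
      open Meta 3 0
  in ((i + pm j k + tw j l) % 3 + 3 * ((j + l) % 2)) mod 6

S3-inv : Fin 6 → Fin 6
S3-inv x =
  let i = toℕ x % 3 ; j = toℕ x / 3
  in (invI j i + 3 * j) mod 6
  where
  invI : ℕ → ℕ → ℕ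
  invI zero    i = (3 ∸ i) % 3
  invI (suc _) i = i

Dic3-mul : Fin 12 → Fin 12 → Fin 12
Dic3-mul x y =
  let i = toℕ x % 6 ; j = toℕ x / 6 ; k = toℕ y % 6 ; l = toℕ y / 6
      open Meta 6 3
  in ((i + pm j k + tw j l) % 6 + 6 * ((j + l) % 2)) mod 12

Dic3-inv : Fin 12 → Fin 12
Dic3-inv x =
  let i = toℕ x % 6 ; j = toℕ x / 6
  in (invI j i + 6 * j) mod 12
  where
  invI : ℕ → ℕ → ℕ
  invI zero    i = (6 ∸ i) % 6
  invI (suc _) i = (i + 3) % 6

-- For S₃ take f = δ_b − δ_{ab}, and for the dicyclic group
-- f = δ_b + δ_{a³b} − δ_{ab} − δ_{a⁴b}.  The characteristic polynomials of the
-- resulting Cayley colour graphs are p = x²(x² − 3)² and p = x⁸(x² − 12)².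
-- As 3 and 12 are not squares modulo 5, p(1), …, p(4) are prime to 5, so every
-- integer eigenvalue would be divisible by 5 and p(c) ≡ cⁿ (mod 5) would hold
-- for every c; this fails at c = 1 for S₃ and at c = 2 for the dicyclic group.

module Submission where

open import Defs
open import Data.Product using (_×_; _,_)

open import Data.Nat as ℕ using (ℕ; zero; suc; NonZero)
open import Data.Fin as Fin using (Fin; zero; suc; toℕ; punchIn; fromℕ<; #_)
open import Data.Fin.Properties using (all?; toℕ-fromℕ<)
open import Data.Vec using (Vec; _∷_; lookup; tabulate; removeAt; allFin)
open import Data.Vec.Properties using (lookup∘tabulate; lookup-allFin)
open import Data.Integer as ℤ using (ℤ; +_; _*_; _+_; _-_; -_; _^_; 0ℤ; 1ℤ)
open import Data.Integer.Properties using (*-zeroˡ; +-identityˡ; neg-involutive)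
open import Data.Integer.DivMod using (_%ℕ_; _/ℕ_; a≡a%ℕn+[a/ℕn]*n; n%ℕd<d)
open import Data.Integer.Divisibility.Signed
  using (_∣_; _∣?_; divides; ∣-refl; ∣-trans; ∣m⇒∣-m; ∣n⇒∣m*n; ∣m⇒∣m*n; ∣m∣n⇒∣m+n)
open import Data.Integer.Solver using (module +-*-Solver)
open import Data.Bool using (if_then_else_)
open import Data.Empty using (⊥-elim)
open import Relation.Nullary using (¬_; Dec; does; yes; no; ¬?; _→-dec_)
open import Relation.Nullary.Decidable using (from-yes; from-no)
open import Relation.Binary.PropositionalEquality
  using (_≡_; _≢_; _≗_; refl; sym; trans; cong; cong₂; subst; module ≡-Reasoning)

open +-*-Solver

infixl 7 _*′_

-- Unlike _*_, this does not evaluate its second argument when the first is 0,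
-- which is what makes Laplace expansion of sparse matrices feasible by evaluation.
_*′_ : ℤ → ℤ → ℤ
(+ 0) *′ _ = 0ℤ
a     *′ b = a * b

*′≗* : ∀ a b → a *′ b ≡ a * b
*′≗* (+ 0)     b = sym (*-zeroˡ b)
*′≗* (+ suc _) b = refl
*′≗* ℤ.-[1+ _ ] b = refl

sumF-cong : ∀ n {v w : Fin n → ℤ} → v ≗ w → sumF n v ≡ sumF n w
sumF-cong zero    v≗w = refl
sumF-cong (suc n) v≗w = cong₂ _+_ (v≗w zero) (sumF-cong n (λ i → v≗w (suc i)))

det-cong : ∀ n {M N : Matrix n} → (∀ i j → M i j ≡ N i j) → det n M ≡ det n N
det-cong zero    M≡N = refl
det-cong (suc n) M≡N = sumF-cong (suc n) λ j →
  cong₂ (λ a d → altSign (toℕ j) * a * d) (M≡N zero j)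
        (det-cong n (λ r c → M≡N (suc r) (punchIn j c)))

lookup-removeAt : ∀ {A : Set} {n} (xs : Vec A (suc n)) (j : Fin (suc n)) (c : Fin n) →
                  lookup (removeAt xs j) c ≡ lookup xs (punchIn j c)
lookup-removeAt (x ∷ xs)     zero    c       = refl
lookup-removeAt (x ∷ y ∷ xs) (suc j) zero    = refl
lookup-removeAt (x ∷ y ∷ xs) (suc j) (suc c) = lookup-removeAt (y ∷ xs) j c

detMinor : ∀ {N} n → Vec (Vec ℤ N) n → Vec (Fin N) n → ℤ
detMinor zero    _        _  = 1ℤ
detMinor (suc n) (r ∷ rs) cs = sumF (suc n) λ j →
  altSign (toℕ j) * lookup r (lookup cs j) *′ detMinor n rs (removeAt cs j)

detMinor≡det : ∀ {N} n (rs : Vec (Vec ℤ N) n) (cs : Vec (Fin N) n) →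
               detMinor n rs cs ≡ det n (λ a b → lookup (lookup rs a) (lookup cs b))
detMinor≡det zero    _        _  = refl
detMinor≡det (suc n) (r ∷ rs) cs = sumF-cong (suc n) λ j →
  let a = altSign (toℕ j) * lookup r (lookup cs j) in begin
  a *′ detMinor n rs (removeAt cs j)
    ≡⟨ *′≗* a _ ⟩
  a * detMinor n rs (removeAt cs j)
    ≡⟨ cong (a *_) (detMinor≡det n rs (removeAt cs j)) ⟩
  a * det n (λ r c → lookup (lookup rs r) (lookup (removeAt cs j) c))
    ≡⟨ cong (a *_) (det-cong n λ r c → cong (lookup (lookup rs r)) (lookup-removeAt cs j c)) ⟩
  a * det n (λ r c → lookup (lookup rs r) (lookup cs (punchIn j c)))
    ∎
  where open ≡-Reasoning

det≡detMinor-tabulate : ∀ n (M : Matrix n) →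
                        det n M ≡ detMinor n (tabulate λ i → tabulate (M i)) (allFin n)
det≡detMinor-tabulate n M =
  trans (det-cong n λ i j → sym (entry i j)) (sym (detMinor≡det n _ (allFin n)))
  where
  open ≡-Reasoning
  entry : ∀ i j → lookup (lookup (tabulate λ i → tabulate (M i)) i) (lookup (allFin n) j) ≡ M i j
  entry i j = begin
    lookup (lookup (tabulate λ i → tabulate (M i)) i) (lookup (allFin n) j)
      ≡⟨ cong₂ lookup (lookup∘tabulate (λ i → tabulate (M i)) i) (lookup-allFin j) ⟩
    lookup (tabulate (M i)) j
      ≡⟨ lookup∘tabulate (M i) j ⟩
    M i j
      ∎

charMatrix : ∀ n → Matrix n → ℤ → Matrix n
charMatrix n A x i j = (if does (i Fin.≟ j) then x else 0ℤ) - A i j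

-- Equal to charPolyAt, but evaluates fast enough to decide divisibility
-- properties of its values for 12 × 12 matrices.
evalCharPolyAt : ∀ n → Matrix n → ℤ → ℤ
evalCharPolyAt n A x = detMinor n (tabulate λ i → tabulate (charMatrix n A x i)) (allFin n)

charPolyAt≗evalCharPolyAt : ∀ n (A : Matrix n) → charPolyAt n A ≗ evalCharPolyAt n A
charPolyAt≗evalCharPolyAt n A x = det≡detMinor-tabulate n (charMatrix n A x)

∣-prodF : ∀ n (v : Fin n → ℤ) i → v i ∣ prodF n v
∣-prodF (suc n) v zero    = ∣m⇒∣m*n _ ∣-refl
∣-prodF (suc n) v (suc i) = ∣n⇒∣m*n (v zero) (∣-prodF n (λ i → v (suc i)) i)

prodF-const : ∀ n c → prodF n (λ _ → c) ≡ c ^ n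
prodF-const zero    c = refl
prodF-const (suc n) c = cong (c *_) (prodF-const n c)

prodF-cong-∣ : ∀ {d} n (u w : Fin n → ℤ) → (∀ i → d ∣ u i - w i) →
               d ∣ prodF n u - prodF n w
prodF-cong-∣ zero    u w _   = divides 0ℤ refl
prodF-cong-∣ (suc n) u w d∣ = subst (_ ∣_) (sym split)
  (∣m∣n⇒∣m+n (∣n⇒∣m*n (u zero) (prodF-cong-∣ n _ _ (λ i → d∣ (suc i))))
             (∣m⇒∣m*n W (d∣ zero)))
  where
  U = prodF n (λ i → u (suc i))
  W = prodF n (λ i → w (suc i))
  split : u zero * U - w zero * W ≡ u zero * (U - W) + (u zero - w zero) * W
  split = solve 4 (λ a b x y → a :* x :- b :* y := a :* (x :- y) :+ (a :- b) :* y)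
                refl (u zero) (w zero) U W

∣-residue : ∀ q .{{_ : NonZero q}} e → + q ∣ + (e %ℕ q) - e
∣-residue q e = divides (- (e /ℕ q)) (begin
  + (e %ℕ q) - e                          ≡⟨ cong (λ t → + (e %ℕ q) - t) (a≡a%ℕn+[a/ℕn]*n e q) ⟩
  + (e %ℕ q) - (+ (e %ℕ q) + e /ℕ q * + q) ≡⟨ solve 3 (λ r k d → r :- (r :+ k :* d) := :- k :* d)
                                                     refl (+ (e %ℕ q)) (e /ℕ q) (+ q) ⟩
  - (e /ℕ q) * + q                         ∎)
  where open ≡-Reasoning

NoNonzeroRootMod : ℕ → (ℤ → ℤ) → Set
NoNonzeroRootMod q P = (r : Fin q) → toℕ r ≢ 0 → ¬ + q ∣ P (+ toℕ r)

noNonzeroRootMod? : ∀ q P → Dec (NoNonzeroRootMod q P)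
noNonzeroRootMod? q P = all? λ r → ¬? (toℕ r ℕ.≟ 0) →-dec ¬? (+ q ∣? P (+ toℕ r))

module _ (q : ℕ) .{{_ : NonZero q}} {n} (P : ℤ → ℤ) (e : Fin n → ℤ)
         (P-splits : ∀ x → P x ≡ prodF n (λ i → x - e i))
         (noRoot : NoNonzeroRootMod q P) where

  ∣-roots : ∀ i → + q ∣ e i
  ∣-roots i = by-residue (toℕ r ℕ.≟ 0)
    where
    r : Fin q
    r = fromℕ< (n%ℕd<d (e i) q)
    q∣r-e : + q ∣ + toℕ r - e i
    q∣r-e = subst (λ k → + q ∣ + k - e i) (sym (toℕ-fromℕ< _)) (∣-residue q (e i))
    r-e∣Pr : + toℕ r - e i ∣ P (+ toℕ r)
    r-e∣Pr = subst (+ toℕ r - e i ∣_) (sym (P-splits _)) (∣-prodF n _ i)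
    by-residue : Dec (toℕ r ≡ 0) → + q ∣ e i
    by-residue (yes r≡0) = subst (+ q ∣_) (trans (cong -_ (+-identityˡ (- e i))) (neg-involutive (e i)))
                             (∣m⇒∣-m (subst (λ k → + q ∣ + k - e i) r≡0 q∣r-e))
    by-residue (no  r≢0) = ⊥-elim (noRoot r r≢0 (∣-trans q∣r-e r-e∣Pr))

  ∣-sub-pow : ∀ c → + q ∣ P c - c ^ n
  ∣-sub-pow c = subst (+ q ∣_) (cong₂ _-_ (sym (P-splits c)) (prodF-const n c))
    (prodF-cong-∣ n _ _ λ i → subst (+ q ∣_) (solve 2 (λ c e → :- e := c :- e :- c) refl c (e i))
                                            (∣m⇒∣-m (∣-roots i)))

¬Integral-mod : ∀ n (A : Matrix n) (P : ℤ → ℤ) → charPolyAt n A ≗ P →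
                ∀ q .{{_ : NonZero q}} → NoNonzeroRootMod q P →
                ∀ c → ¬ + q ∣ P c - c ^ n → ¬ Integral n A
¬Integral-mod n A P A≗P q noRoot c q∤ (e , split) =
  q∤ (∣-sub-pow q P e (λ x → trans (sym (A≗P x)) (split x)) noRoot c)

δ : ∀ {n} → Fin n → Fin n → ℤ
δ x y = if does (x Fin.≟ y) then 1ℤ else 0ℤ

fS3 : Fin 6 → ℤ
fS3 g = δ (# 3) g - δ (# 4) g

fDic3 : Fin 12 → ℤ
fDic3 g = δ (# 6) g + δ (# 9) g - δ (# 7) g - δ (# 10) g

fS3-symmetric : ∀ g → fS3 g ≡ fS3 (S3-inv g)
fS3-symmetric = from-yes (all? λ g → fS3 g ℤ.≟ fS3 (S3-inv g))

fDic3-symmetric : ∀ g → fDic3 g ≡ fDic3 (Dic3-inv g)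
fDic3-symmetric = from-yes (all? λ g → fDic3 g ℤ.≟ fDic3 (Dic3-inv g))

¬CayleyColourIntegral-S3 : ¬ CayleyColourIntegral 6 S3-mul S3-inv
¬CayleyColourIntegral-S3 cci =
  let A = cayAdj 6 S3-mul S3-inv fS3 in
  ¬Integral-mod 6 A (evalCharPolyAt 6 A) (charPolyAt≗evalCharPolyAt 6 A)
    5 (from-yes (noNonzeroRootMod? 5 (evalCharPolyAt 6 A)))
    1ℤ (from-no (+ 5 ∣? evalCharPolyAt 6 A 1ℤ - 1ℤ ^ 6))
    (cci fS3 fS3-symmetric)

¬CayleyColourIntegral-Dic3 : ¬ CayleyColourIntegral 12 Dic3-mul Dic3-inv
¬CayleyColourIntegral-Dic3 cci =
  let A = cayAdj 12 Dic3-mul Dic3-inv fDic3 in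
  ¬Integral-mod 12 A (evalCharPolyAt 12 A) (charPolyAt≗evalCharPolyAt 12 A)
    5 (from-yes (noNonzeroRootMod? 5 (evalCharPolyAt 12 A)))
    (+ 2) (from-no (+ 5 ∣? evalCharPolyAt 12 A (+ 2) - (+ 2) ^ 12))
    (cci fDic3 fDic3-symmetric)

mainTheorem6 : ¬ CayleyColourIntegral 6 S3-mul S3-inv
               × ¬ CayleyColourIntegral 12 Dic3-mul Dic3-inv
mainTheorem6 = ¬CayleyColourIntegral-S3 , ¬CayleyColourIntegral-Dic3
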